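{- Let $G$ be a graph, $S\subseteq V(G)$, and $H=G[S]$. Let $uv\in E(G)$. Then $uv$ is $H$-critical for $S$ if and only if either (1) both $u,v\in S$, or (2) exactly one endpoint, say $v$, lies in $S$, and $u$ is not a corner dominated by $v$ in the induced subgraph $G[S\cup\{u\}]$ (that is, the closed neighbourhood of $u$ in $G[S\cup\{u\}]$ is not contained in the closed neighbourhood of $v$ in $G[S\cup\{u\}]$).
   Context: All graphs are finite and simple. For an edge $uv$ of $G$, the contraction $G/uv$ is obtained by deleting $u,v$ and adding a new vertex $w$ adjacent to every vertex of $(N(u)\cup N(v))\setminus\{u,v\}$. Define $f:2^{V(G)}\to 2^{V(G/uv)}$ by $f(S)=S$ if $u,v\notin S$ and $f(S)=(S\cup\{w\})\setminus\{u,v\}$ otherwise. For $S\subseteq V(G)$ with $G[S]\cong H$, the edge $uv$ is $H$-critical for $S$ if the induced subgraph $(G/uv)[f(S)]$ is not isomorphic to $H$. -}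

module Defs where

open import Data.Bool using (Bool; true; false; not; _∧_; _∨_; T)
open import Data.Fin using (Fin; _≟_)
open import Data.Maybe using (Maybe; just; nothing)
open import Data.Nat using (ℕ)
open import Data.Product using (Σ; _×_)
open import Data.Sum using (_⊎_)
open import Relation.Binary.PropositionalEquality using (_≡_)
open import Relation.Nullary using (¬_)
open import Relation.Nullary.Decidable using (⌊_⌋)

record Graph (V : Set) : Set where
  field
    adj  : V → V → Bool
    sym  : ∀ x y → adj x y ≡ adj y x
    irr  : ∀ x → adj x x ≡ false
open Graph public

Sub : {V : Set} → (V → Bool) → Set
Sub {V} S = Σ V (λ x → T (S x))

record InducedIso {V W : Set} (G₁ : Graph V) (S₁ : V → Bool)
                  (G₂ : Graph W) (S₂ : W → Bool) : Set where
  field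
    to      : Sub S₁ → Sub S₂
    from    : Sub S₂ → Sub S₁
    from∘to : ∀ x → from (to x) ≡ x
    to∘from : ∀ y → to (from y) ≡ y
    pres    : ∀ x y → adj G₁ (Σ.proj₁ x) (Σ.proj₁ y)
                      ≡ adj G₂ (Σ.proj₁ (to x)) (Σ.proj₁ (to y))

Rest : {n : ℕ} → Fin n → Fin n → Set
Rest {n} u v = Σ (Fin n) (λ x → T (not ⌊ x ≟ u ⌋ ∧ not ⌊ x ≟ v ⌋))

-- Vertex set of G/uv: nothing is the new vertex w, just x is an old vertex x ∉ {u,v}.
CV : {n : ℕ} → Fin n → Fin n → Set
CV u v = Maybe (Rest u v)

private
  ∨-comm : ∀ a b → (a ∨ b) ≡ (b ∨ a)
  ∨-comm true true = _≡_.refl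
  ∨-comm true false = _≡_.refl
  ∨-comm false true = _≡_.refl
  ∨-comm false false = _≡_.refl

module _ {n : ℕ} (G : Graph (Fin n)) (u v : Fin n) where
  cadj : CV u v → CV u v → Bool
  cadj nothing  nothing  = false
  cadj nothing  (just y) = adj G u (Σ.proj₁ y) ∨ adj G v (Σ.proj₁ y)
  cadj (just x) nothing  = adj G (Σ.proj₁ x) u ∨ adj G (Σ.proj₁ x) v
  cadj (just x) (just y) = adj G (Σ.proj₁ x) (Σ.proj₁ y)

  private
    csym : ∀ x y → cadj x y ≡ cadj y x
    csym nothing nothing = _≡_.refl
    csym nothing (just y)
      rewrite sym G u (Σ.proj₁ y) | sym G v (Σ.proj₁ y) = _≡_.refl
    csym (just x) nothing
      rewrite sym G (Σ.proj₁ x) u | sym G (Σ.proj₁ x) v = _≡_.refl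
    csym (just x) (just y) = sym G (Σ.proj₁ x) (Σ.proj₁ y)

    cirr : ∀ x → cadj x x ≡ false
    cirr nothing = _≡_.refl
    cirr (just x) = irr G (Σ.proj₁ x)

  contract : Graph (CV u v)
  contract = record { adj = cadj ; sym = csym ; irr = cirr }

  fSet : (Fin n → Bool) → CV u v → Bool
  fSet S nothing  = S u ∨ S v
  fSet S (just x) = S (Σ.proj₁ x)

Critical : {n : ℕ} → Graph (Fin n) → (Fin n → Bool) → Fin n → Fin n → Set
Critical G S u v = ¬ InducedIso (contract G u v) (fSet G u v S) G S

DominatedCorner : {n : ℕ} → Graph (Fin n) → (Fin n → Bool) → Fin n → Fin n → Set
DominatedCorner G S a b =
  ∀ x → T (S x ∨ ⌊ x ≟ a ⌋) →
    (x ≡ a ⊎ adj G a x ≡ true) → (x ≡ b ⊎ adj G b x ≡ true)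

-- Let w be the merged vertex of G/uv.  For an endpoint a ∈ S, the map ν sending w to a and
-- fixing every other vertex of f(S) is injective, and every edge of G[S] between vertices in
-- its image is an edge of (G/uv)[f(S)].  If both endpoints lie in S, ν misses the other one,
-- so |f(S)| < |S|.  If neither does, f(S) = S and nothing changes.  If only a ∈ S, ν is a
-- bijection, and it is an isomorphism exactly when the other endpoint o contributes no new
-- neighbour of w in S, i.e. when o is dominated by a in G[S ∪ {o}].  Conversely, any
-- isomorphism forces ν to be one: an injective self-map of a finite set cannot move a point
-- from outside an invariant subset into it, and applied to pairs of vertices this means that
-- ν cannot gain an edge without losing another.
module Submission where

open import Defs renaming (sym to adj-sym)
open import Data.Bool using (Bool; true; false; not; _∧_; _∨_; T)
open import Data.Bool.Properties using (T-irrelevant; T-≡; T-∨; ∨-comm; ∨-zeroʳ; ¬-not; not-¬)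
open import Data.Empty using (⊥-elim)
open import Data.Fin using (Fin; _≟_)
open import Data.Fin.Properties using (ℕ→Fin-notInjective; *↔×)
open import Data.Maybe using (just; nothing)
open import Data.Nat using (ℕ; zero; suc; _*_)
open import Data.Product using (Σ; _×_; _,_; proj₁; proj₂; uncurry)
open import Data.Product.Function.NonDependent.Propositional using (_×-↣_)
open import Data.Product.Properties using (,-injective)
open import Data.Sum using (_⊎_; inj₁; inj₂)
open import Data.Unit using (tt)
import Function.Endo.Propositional as Endo
open import Function using (_∘_; Injective; Injection; _↣_; _⇔_; mk⇔; mk↣; Equivalence)
open import Function.Properties.Injection using (↣-trans)
open import Function.Properties.Inverse using (↔-sym; ↔⇒↣)
open import Relation.Binary.PropositionalEquality
  using (_≡_; _≢_; refl; sym; trans; cong; cong₂; subst; subst₂)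
open import Relation.Nullary using (¬_; yes; no)
open import Relation.Nullary.Decidable using (⌊_⌋)

private
  variable
    A : Set
    m n : ℕ

Σ-T-≡ : {P : A → Bool} {x y : Σ A (T ∘ P)} → proj₁ x ≡ proj₁ y → x ≡ y
Σ-T-≡ {x = a , p} {.a , q} refl = cong (a ,_) (T-irrelevant p q)

∨-redundantʳ : ∀ {b c} → (c ≡ true → b ≡ true) → b ∨ c ≡ b
∨-redundantʳ {true}          _ = refl
∨-redundantʳ {false} {false} _ = refl
∨-redundantʳ {false} {true}  c⇒b = sym (c⇒b refl)

contrapositiveᵇ : ∀ {b c} → (b ≡ true → c ≡ true) → c ≡ false → b ≡ false
contrapositiveᵇ b⇒c c≡false = ¬-not (λ b≡true → not-¬ (b⇒c b≡true) c≡false)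

module _ {X : Set} (finite : X ↣ Fin m) {μ : X → X} (μ-injective : Injective _≡_ _≡_ μ) where
  open Endo X using (_^_)

  -- The orbit of μ x stays in P, and it cannot return to μ x without passing through x.
  ¬-invariant : (P : X → Set) → (∀ {x} → P x → P (μ x)) → ∀ {x} → ¬ P x → ¬ P (μ x)
  ¬-invariant P μ-preserves-P {x} ¬Px Pμx =
    ℕ→Fin-notInjective (Injection.to finite ∘ orbit) (orbit-injective ∘ Injection.injective finite)
    where
    orbit : ℕ → X
    orbit k = (μ ^ k) (μ x)

    P-orbit : ∀ k → P (orbit k)
    P-orbit zero    = Pμx
    P-orbit (suc k) = μ-preserves-P (P-orbit k)

    orbit-injective : Injective _≡_ _≡_ orbit
    orbit-injective {zero}  {zero}  _  = refl
    orbit-injective {zero}  {suc j} eq = ⊥-elim (¬Px (subst P (sym (μ-injective eq)) (P-orbit j)))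
    orbit-injective {suc i} {zero}  eq = ⊥-elim (¬Px (subst P (μ-injective eq) (P-orbit i)))
    orbit-injective {suc i} {suc j} eq = cong suc (orbit-injective (μ-injective eq))

  injective⇒¬avoids : ∀ y → ¬ (∀ x → μ x ≢ y)
  injective⇒¬avoids y avoids =
    ¬-invariant (_≢ y) (λ {x} _ → avoids x) (λ y≢y → y≢y refl) (λ μy≡y → avoids y μy≡y)

×-finite : A ↣ Fin m → (A × A) ↣ Fin (m * m)
×-finite finite = ↣-trans (finite ×-↣ finite) (↔⇒↣ (↔-sym *↔×))

Sub-finite : {S : Fin n → Bool} → Sub S ↣ Fin n
Sub-finite = mk↣ Σ-T-≡

adjˢ : {V : Set} {S : V → Bool} → Graph V → Sub S → Sub S → Bool
adjˢ G x y = adj G (proj₁ x) (proj₁ y)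

module _ {V W : Set} {G₁ : Graph V} {S₁ : V → Bool} {G₂ : Graph W} {S₂ : W → Bool}
         (I : InducedIso G₁ S₁ G₂ S₂) (finite : Sub S₂ ↣ Fin m) where
  open InducedIso I

  from-injective : Injective _≡_ _≡_ from
  from-injective {x} {y} eq = trans (sym (to∘from x)) (trans (cong to eq) (to∘from y))

  iso⇒¬injection-avoiding : {g : Sub S₁ → Sub S₂} → Injective _≡_ _≡_ g → ∀ y → ¬ (∀ x → g x ≢ y)
  iso⇒¬injection-avoiding g-injective y avoids =
    injective⇒¬avoids finite (from-injective ∘ g-injective) y (avoids ∘ from)

  iso⇒monotone-injection-reflects-edges :
    {ν : Sub S₁ → Sub S₂} → Injective _≡_ _≡_ ν →
    (∀ x y → adjˢ G₂ (ν x) (ν y) ≡ true → adjˢ G₁ x y ≡ true) →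
    ∀ x y → adjˢ G₁ x y ≡ true → adjˢ G₂ (ν x) (ν y) ≡ true
  iso⇒monotone-injection-reflects-edges {ν} ν-injective monotone x y xy =
    ¬-not (subst₂ (λ x′ y′ → ¬ NonEdge (ν x′ , ν y′)) (from∘to x) (from∘to y)
            (¬-invariant (×-finite finite) μ-injective NonEdge μ-preserves-NonEdge
              {to x , to y} (not-¬ (trans (sym (pres x y)) xy))))
    where
    NonEdge : Sub S₂ × Sub S₂ → Set
    NonEdge = uncurry λ p q → adjˢ G₂ p q ≡ false

    μ : Sub S₂ × Sub S₂ → Sub S₂ × Sub S₂
    μ (p , q) = ν (from p) , ν (from q)

    μ-injective : Injective _≡_ _≡_ μ
    μ-injective {_ , _} {_ , _} eq = cong₂ _,_
      (from-injective (ν-injective (proj₁ (,-injective eq))))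
      (from-injective (ν-injective (proj₂ (,-injective eq))))

    μ-preserves-NonEdge : ∀ {z} → NonEdge z → NonEdge (μ z)
    μ-preserves-NonEdge {p , q} pq =
      contrapositiveᵇ (monotone (from p) (from q))
        (trans (pres (from p) (from q))
          (subst₂ (λ p′ q′ → adjˢ G₂ p′ q′ ≡ false) (sym (to∘from p)) (sym (to∘from q)) pq))

NotEnd : Fin n → Fin n → Fin n → Set
NotEnd u v x = T (not ⌊ x ≟ u ⌋ ∧ not ⌊ x ≟ v ⌋)

module _ {u v x : Fin n} where
  notEnd-≢ˡ : NotEnd u v x → x ≢ u
  notEnd-≢ˡ r x≡u with x ≟ u
  ... | yes _   = r
  ... | no  x≢u = x≢u x≡u

  notEnd-≢ʳ : NotEnd u v x → x ≢ v
  notEnd-≢ʳ r x≡v with x ≟ u | x ≟ v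
  ... | yes _ | _       = r
  ... | no _  | yes _   = r
  ... | no _  | no  x≢v = x≢v x≡v

  notEnd-intro : x ≢ u → x ≢ v → NotEnd u v x
  notEnd-intro x≢u x≢v with x ≟ u | x ≟ v
  ... | yes x≡u | _       = x≢u x≡u
  ... | no _    | yes x≡v = x≢v x≡v
  ... | no _    | no _    = tt

data Endpoints (u v : Fin n) : Fin n → Fin n → Set where
  in-order : Endpoints u v u v
  swapped  : Endpoints u v v u

module _ {u v a o : Fin n} where
  notEnd-≢ : Endpoints u v a o → ∀ {x} → NotEnd u v x → x ≢ a × x ≢ o
  notEnd-≢ in-order r = notEnd-≢ˡ r , notEnd-≢ʳ r
  notEnd-≢ swapped  r = notEnd-≢ʳ r , notEnd-≢ˡ r

  notEnd-intro′ : Endpoints u v a o → ∀ {x} → x ≢ a → x ≢ o → NotEnd u v x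
  notEnd-intro′ in-order x≢a x≢o = notEnd-intro x≢a x≢o
  notEnd-intro′ swapped  x≢a x≢o = notEnd-intro x≢o x≢a

  adj-endpoints : (G : Graph (Fin n)) → Endpoints u v a o → adj G u v ≡ true → adj G a o ≡ true
  adj-endpoints G in-order uv = uv
  adj-endpoints G swapped  uv = trans (adj-sym G v u) uv

  adj-merged : (G : Graph (Fin n)) → Endpoints u v a o → ∀ y →
    adj (contract G u v) nothing (just y) ≡ adj G a (proj₁ y) ∨ adj G o (proj₁ y)
  adj-merged G in-order y = refl
  adj-merged G swapped  y = ∨-comm (adj G u (proj₁ y)) (adj G v (proj₁ y))

  merged-∈ : (G : Graph (Fin n)) (S : Fin n → Bool) → Endpoints u v a o → T (S a) →
    T (fSet G u v S nothing)
  merged-∈ G S in-order Sa = Equivalence.from T-∨ (inj₁ Sa)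
  merged-∈ G S swapped  Sa = Equivalence.from T-∨ (inj₂ Sa)

irreflexive : {V : Set} (G : Graph V) → ∀ {x y} → adj G x y ≡ true → x ≢ y
irreflexive G {x} xy refl with trans (sym xy) (irr G x)
... | ()

∈⇒≢∉ : ∀ {S : A → Bool} {x y} → T (S x) → S y ≡ false → x ≢ y
∈⇒≢∉ Sx Sy refl = subst T Sy Sx

∈-∪-≢ : ∀ {S : Fin n → Bool} {x o} → T (S x ∨ ⌊ x ≟ o ⌋) → x ≢ o → T (S x)
∈-∪-≢ {x = x} {o} x∈ x≢o with x ≟ o
... | yes x≡o = ⊥-elim (x≢o x≡o)
... | no _ with Equivalence.to T-∨ x∈
...   | inj₁ Sx = Sx

module _ {n : ℕ} (G : Graph (Fin n)) (S : Fin n → Bool) (u v : Fin n) where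
  private
    C  = contract G u v
    fS = fSet G u v S

  contract-iso-if-∉ : S u ≡ false → S v ≡ false → InducedIso C fS G S
  contract-iso-if-∉ Su Sv = record
    { to = to ; from = from ; from∘to = from∘to ; to∘from = λ _ → refl ; pres = pres }
    where
    merged-∉ : ¬ T (S u ∨ S v)
    merged-∉ rewrite Su | Sv = λ ()

    to : Sub fS → Sub S
    to (nothing , p)      = ⊥-elim (merged-∉ p)
    to (just (x , _) , p) = x , p

    from : Sub S → Sub fS
    from (x , p) = just (x , notEnd-intro (∈⇒≢∉ {S = S} p Su) (∈⇒≢∉ {S = S} p Sv)) , p

    from∘to : ∀ b → from (to b) ≡ b
    from∘to (nothing , p)      = ⊥-elim (merged-∉ p)
    from∘to (just (x , r) , p) = cong (λ r′ → just (x , r′) , p) (T-irrelevant _ r)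

    pres : ∀ b c → adjˢ C b c ≡ adjˢ G (to b) (to c)
    pres (nothing , p) _             = ⊥-elim (merged-∉ p)
    pres (just _ , _) (nothing , p)  = ⊥-elim (merged-∉ p)
    pres (just _ , _) (just _ , _)   = refl

  module Unmerge {a o : Fin n} (ends : Endpoints u v a o) (Sa : S a ≡ true) where
    Ta : T (S a)
    Ta = Equivalence.from T-≡ Sa

    w : Sub fS
    w = nothing , merged-∈ G S ends Ta

    unmerge : Sub fS → Sub S
    unmerge (nothing , _)      = a , Ta
    unmerge (just (x , _) , p) = x , p

    unmerge-injective : Injective _≡_ _≡_ unmerge
    unmerge-injective {nothing , _} {nothing , _} _ = Σ-T-≡ refl
    unmerge-injective {nothing , _} {just (_ , r) , _} eq =
      ⊥-elim (proj₁ (notEnd-≢ ends r) (sym (cong proj₁ eq)))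
    unmerge-injective {just (_ , r) , _} {nothing , _} eq =
      ⊥-elim (proj₁ (notEnd-≢ ends r) (cong proj₁ eq))
    unmerge-injective {just _ , _} {just _ , _} eq = Σ-T-≡ (cong just (Σ-T-≡ (cong proj₁ eq)))

    unmerge-monotone : ∀ b c → adjˢ G (unmerge b) (unmerge c) ≡ true → adjˢ C b c ≡ true
    unmerge-monotone (nothing , _) (nothing , _) aa = ⊥-elim (irreflexive G aa refl)
    unmerge-monotone (nothing , _) (just y , _)  ay =
      trans (adj-merged G ends y) (cong (_∨ adj G o (proj₁ y)) ay)
    unmerge-monotone (just x , p) (nothing , q) xa =
      trans (adj-sym C (just x) nothing)
        (unmerge-monotone (nothing , q) (just x , p) (trans (adj-sym G a (proj₁ x)) xa))
    unmerge-monotone (just _ , _) (just _ , _)   xy = xy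

  critical-if-∈ : adj G u v ≡ true → S u ≡ true → S v ≡ true → Critical G S u v
  critical-if-∈ uv Su Sv I =
    iso⇒¬injection-avoiding I Sub-finite unmerge-injective (v , Equivalence.from T-≡ Sv)
      (λ b eq → avoids-v b (cong proj₁ eq))
    where
    open Unmerge in-order Su
    avoids-v : ∀ b → proj₁ (unmerge b) ≢ v
    avoids-v (nothing , _)      = irreflexive G uv
    avoids-v (just (_ , r) , _) = notEnd-≢ʳ r

  module OneEndpoint {a o : Fin n} (ends : Endpoints u v a o) (uv : adj G u v ≡ true)
                     (Sa : S a ≡ true) (So : S o ≡ false) where
    open Unmerge ends Sa

    merge : Sub S → Sub fS
    merge (x , p) with x ≟ a
    ... | yes _   = w
    ... | no  x≢a = just (x , notEnd-intro′ ends x≢a (∈⇒≢∉ {S = S} p So)) , p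

    unmerge∘merge : ∀ x → unmerge (merge x) ≡ x
    unmerge∘merge (x , p) with x ≟ a
    ... | yes refl = Σ-T-≡ refl
    ... | no  _    = refl

    merge∘unmerge : ∀ b → merge (unmerge b) ≡ b
    merge∘unmerge b = unmerge-injective (unmerge∘merge (unmerge b))

    iso-if-dominated : DominatedCorner G S o a → InducedIso C fS G S
    iso-if-dominated dom = record
      { to = unmerge ; from = merge ; from∘to = merge∘unmerge ; to∘from = unmerge∘merge
      ; pres = pres }
      where
      adj-merged-∈ : ∀ y → T (S (proj₁ y)) → adj C nothing (just y) ≡ adj G a (proj₁ y)
      adj-merged-∈ y@(y₀ , r) Sy = trans (adj-merged G ends y) (∨-redundantʳ oy⇒ay)
        where
        oy⇒ay : adj G o y₀ ≡ true → adj G a y₀ ≡ true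
        oy⇒ay oy with dom y₀ (Equivalence.from T-∨ (inj₁ Sy)) (inj₂ oy)
        ... | inj₁ y≡a = ⊥-elim (proj₁ (notEnd-≢ ends r) y≡a)
        ... | inj₂ ay  = ay

      pres : ∀ b c → adjˢ C b c ≡ adjˢ G (unmerge b) (unmerge c)
      pres (nothing , _) (nothing , _) = sym (irr G a)
      pres (nothing , _) (just y , Sy) = adj-merged-∈ y Sy
      pres (just x , Sx) (nothing , _) =
        trans (adj-sym C (just x) nothing)
          (trans (adj-merged-∈ x Sx) (adj-sym G a (proj₁ x)))
      pres (just _ , _) (just _ , _)   = refl

    dominated-if-iso : InducedIso C fS G S → DominatedCorner G S o a
    dominated-if-iso I x x∈ ox with x ≟ a
    ... | yes x≡a = inj₁ x≡a
    ... | no  x≢a with ox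
    ...   | inj₁ refl = inj₂ (adj-endpoints G ends uv)
    ...   | inj₂ ox′  = inj₂ (iso⇒monotone-injection-reflects-edges I Sub-finite
                               unmerge-injective unmerge-monotone w (just (x , r) , Sx) wx)
      where
      x≢o : x ≢ o
      x≢o x≡o = irreflexive G ox′ (sym x≡o)
      Sx : T (S x)
      Sx = ∈-∪-≢ {S = S} x∈ x≢o
      r : NotEnd u v x
      r = notEnd-intro′ ends x≢a x≢o
      wx : adj C nothing (just (x , r)) ≡ true
      wx = trans (adj-merged G ends (x , r)) (trans (cong (adj G a x ∨_) ox′) (∨-zeroʳ _))

  critical⇔¬dominated : {a o : Fin n} → Endpoints u v a o → adj G u v ≡ true →
    S a ≡ true → S o ≡ false → Critical G S u v ⇔ (¬ DominatedCorner G S o a)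
  critical⇔¬dominated ends uv Sa So =
    mk⇔ (λ critical → critical ∘ iso-if-dominated) (λ ¬dominated → ¬dominated ∘ dominated-if-iso)
    where open OneEndpoint ends uv Sa So

  Criterion : Set
  Criterion = (S u ≡ true × S v ≡ true)
            ⊎ ((S v ≡ true × S u ≡ false × ¬ DominatedCorner G S u v)
            ⊎ (S u ≡ true × S v ≡ false × ¬ DominatedCorner G S v u))

  critical⇒criterion : adj G u v ≡ true → Critical G S u v → Criterion
  critical⇒criterion uv critical with S u in Su | S v in Sv
  ... | true  | true  = inj₁ (refl , refl)
  ... | false | true  =
    inj₂ (inj₁ (refl , refl , Equivalence.to (critical⇔¬dominated swapped uv Sv Su) critical))
  ... | true  | false =
    inj₂ (inj₂ (refl , refl , Equivalence.to (critical⇔¬dominated in-order uv Su Sv) critical))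
  ... | false | false = ⊥-elim (critical (contract-iso-if-∉ Su Sv))

  criterion⇒critical : adj G u v ≡ true → Criterion → Critical G S u v
  criterion⇒critical uv (inj₁ (Su , Sv))             = critical-if-∈ uv Su Sv
  criterion⇒critical uv (inj₂ (inj₁ (Sv , Su , ¬d))) =
    Equivalence.from (critical⇔¬dominated swapped uv Sv Su) ¬d
  criterion⇒critical uv (inj₂ (inj₂ (Su , Sv , ¬d))) =
    Equivalence.from (critical⇔¬dominated in-order uv Su Sv) ¬d

theorem13 : (n : ℕ) (G : Graph (Fin n)) (S : Fin n → Bool) (u v : Fin n) →
    adj G u v ≡ true →
    (Critical G S u v ⇔
      ((S u ≡ true × S v ≡ true)
      ⊎ ((S v ≡ true × S u ≡ false × ¬ DominatedCorner G S u v)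
      ⊎ (S u ≡ true × S v ≡ false × ¬ DominatedCorner G S v u))))
theorem13 n G S u v uv = mk⇔ (critical⇒criterion G S u v uv) (criterion⇒critical G S u v uv)
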